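{- Assume that every finite simple graph $G$ satisfies $q_{list}(G)\le \Delta(G)+1$, where $\Delta(G)$ is the maximum degree of $G$. Let $H=(V,E)$ be a finite linear hypergraph with $n$ vertices, let $H_3=(V,E_3)$ where $E_3$ is the set of edges of $H$ of rank at least $3$, and let $\Delta$ be the maximum degree of $H_3$. For a vertex $x$ let $d(x)$ be its degree in $H_3$ and $d_k(x)$ the number of edges of $H$ of rank $k$ containing $x$. Suppose that for every vertex $x$, $$\sum_{k\ge 4}(k-3)d_k(x)\ \ge\ 2\bigl(\Delta-d(x)\bigr).$$ Then every edge coloring of $H_3$ with colors from a set of $n$ colors can be extended to an edge coloring of $H$ using colors from the same set of $n$ colors.
   Context: A hypergraph $H=(V,E)$ is a finite set $V$ with a set $E$ of subsets of $V$ (edges); the rank of an edge is its cardinality, the degree of a vertex is the number of edges containing it, and $H$ is linear if any two distinct edges share at most one vertex. An edge coloring is a map $\gamma$ from the edges to a set of colors such that $\gamma(e)=\gamma(f)$ for distinct edges $e,f$ only if $e\cap f=\emptyset$. For a graph $G$, $q_{list}(G)$ is the least $k$ such that for every assignment of a list of $k$ colors to each edge of $G$, there is a proper edge coloring of $G$ in which each edge gets a color from its own list. -}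

module Defs where

open import Data.Nat using (ℕ; _≤_; _≤?_; _∸_; _*_; _⊔_; _+_)
open import Data.Fin using (Fin)
open import Data.Fin.Subset using (Subset; _∈_; _∩_; ∣_∣)
open import Data.Fin.Subset.Properties using (_∈?_)
open import Data.List using (List; length; filter; map; foldr; upTo; allFin)
open import Data.Nat.ListAction using (sum)
open import Data.List.Membership.Propositional renaming (_∈_ to _∈ₗ_)
open import Data.List.Relation.Unary.All using (All)
open import Data.List.Relation.Unary.Unique.Propositional using (Unique)
open import Data.Product using (Σ; _×_; ∃)
open import Data.Empty using (⊥)
open import Relation.Binary.PropositionalEquality using (_≡_; _≢_)

Hypergraph : ℕ → Set
Hypergraph n = List (Subset n)

IsHypergraph : ∀ {n} → Hypergraph n → Set
IsHypergraph E = Unique E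

rank : ∀ {n} → Subset n → ℕ
rank e = ∣ e ∣

degree : ∀ {n} → Hypergraph n → Fin n → ℕ
degree E x = length (filter (λ e → x ∈? e) E)

maxDegree : ∀ {n} → Hypergraph n → ℕ
maxDegree {n} E = foldr _⊔_ 0 (map (degree E) (allFin n))

Disjoint : ∀ {n} → Subset n → Subset n → Set
Disjoint e f = ∀ x → x ∈ e → x ∈ f → ⊥

Linear : ∀ {n} → Hypergraph n → Set
Linear E = ∀ e f → e ∈ₗ E → f ∈ₗ E → e ≢ f → ∣ e ∩ f ∣ ≤ 1

-- edge coloring of E (a map on edges; values on non-edges are irrelevant):
-- distinct edges of equal color are disjoint
IsEdgeColoring : ∀ {n} {C : Set} → Hypergraph n → (Subset n → C) → Set
IsEdgeColoring E γ = ∀ e f → e ∈ₗ E → f ∈ₗ E → e ≢ f → γ e ≡ γ f → Disjoint e f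

IsSimpleGraph : ∀ {N} → Hypergraph N → Set
IsSimpleGraph G = Unique G × All (λ e → rank e ≡ 2) G

EdgeChoosable : ∀ {N} → Hypergraph N → ℕ → Set
EdgeChoosable G k =
  (L : Subset _ → List ℕ) →
  (∀ e → e ∈ₗ G → length (L e) ≡ k × Unique (L e)) →
  Σ (Subset _ → ℕ) λ φ → (∀ e → e ∈ₗ G → φ e ∈ₗ L e) × IsEdgeColoring G φ

-- q_list(G) ≤ k  (q_list(G) is the least k with G k-edge-choosable)
QListAtMost : ∀ {N} → Hypergraph N → ℕ → Set
QListAtMost G k = ∃ λ j → j ≤ k × EdgeChoosable G j

ListEdgeColoringConjecture : Set
ListEdgeColoringConjecture =
  ∀ N (G : Hypergraph N) → IsSimpleGraph G → QListAtMost G (maxDegree G + 1)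

H₃ : ∀ {n} → Hypergraph n → Hypergraph n
H₃ E = filter (λ e → 3 ≤? rank e) E

dk : ∀ {n} → Hypergraph n → ℕ → Fin n → ℕ
dk E k x = length (filter (λ e → x ∈? e) (filter (λ e → k Data.Nat.≟ rank e) E))

-- Σ_{k ≥ 4} (k-3) d_k(x)   (ranks are at most n, so k ranges over 4..n)
excess : ∀ {n} → Hypergraph n → Fin n → ℕ
excess {n} E x = sum (map (λ k → (k ∸ 3) * dk E k x) (filter (4 ≤?_) (upTo (n + 1))))

-- For a vertex z, linearity makes {z} and the sets f − z (f ∋ z) pairwise disjoint, so
-- Σ_{f ∋ z} (|f| − 1) < n.  Sorting this sum by rank gives 2 d(z) + d₂(z) + Σ_{k≥4} (k−3) d_k(z) < n,
-- with d₂(z) the number of rank-2 edges at z, and the hypothesis turns this into d₂(z) + 2Δ < n.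
-- Hence every rank-2 edge sees at most 2Δ colours of H₃ at its two ends and keeps at least
-- Δ(G) + 1 ≥ q_list(G) free colours, so the graph G of rank-2 edges can be list-coloured from
-- its free colours.  A rank-1 edge {z} then sees fewer than d(z) + d₂(z) < n colours and takes
-- a free one; rank-0 edges meet nothing.

module Submission where

open import Defs
open import Data.Fin using (Fin; toℕ; fromℕ<)
import Data.Fin.Properties as Finₚ
open import Data.Fin.Subset
  using (Subset; inside; outside; _∈_; _∉_; _∩_; _∪_; _─_; _-_; ⁅_⁆; ⋃; ∣_∣; Nonempty; Empty; _⊆_)
  renaming (⊥ to ∅)
open import Data.Fin.Subset.Properties
  using (_∈?_; nonempty?; ∣p∣≤n; ∣⊥∣≡0; ∉⊥; x∈⁅x⁆; x∈⁅y⁆⇒x≡y; ∣⁅x⁆∣≡1; p⊆q⇒∣p∣≤∣q∣; Empty-unique;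
         x∈p∩q⁺; x∈p∩q⁻; x∈p∪q⁺; x∈p∪q⁻; p─q⊆p; x∈p∧x≢y⇒x∈p-y; x∈p⇒∣p-x∣<∣p∣; ⊆-antisym)
open import Data.List using (List; []; _∷_; filter; length; map; take; allFin; foldr; upTo; _++_)
open import Data.List.Properties
  using (filter-all; filter-none; filter-accept; filter-reject; foldr-preservesᵇ; map-cong-local; map-∘;
         length-map; length-take; length-++; length-tabulate)
open import Data.List.Membership.Propositional using () renaming (_∈_ to _∈ₗ_; _∉_ to _∉ₗ_)
open import Data.List.Membership.Propositional.Properties
  using (∈-allFin; ∈-filter⁻; ∈-filter⁺; ∈-map⁺; ∈-map⁻; ∈-++⁺ˡ; ∈-++⁺ʳ)
import Data.List.Membership.DecPropositional as DecMembership
open import Data.List.Relation.Binary.Sublist.Propositional.Properties using (Any-resp-⊆; take-⊆)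
open import Data.List.Relation.Unary.All as All using (All; []; _∷_)
import Data.List.Relation.Unary.All.Properties as Allₚ
open import Data.List.Relation.Unary.AllPairs using (AllPairs; []; _∷_)
import Data.List.Relation.Unary.AllPairs.Properties as AllPairsₚ
open import Data.List.Relation.Unary.Any using (Any; here; there)
open import Data.List.Relation.Unary.Unique.Propositional using (Unique)
import Data.List.Relation.Unary.Unique.Propositional.Properties as Uniqueₚ
open import Data.Nat using (ℕ; suc; _+_; _*_; _∸_; _⊔_; _≤_; _<_; _≤?_; _<?_; _≟_; z≤n; s≤s)
open import Data.Nat.ListAction using (sum)
open import Data.Nat.Properties
open import Algebra.Properties.CommutativeSemigroup +-commutativeSemigroup using (x∙yz≈y∙xz)
open import Data.Nat.Tactic.RingSolver using (solve-∀)
open import Data.Product using (Σ; ∃₂; _×_; _,_; proj₁; proj₂; uncurry)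
open import Data.Sum using (_⊎_; inj₁; inj₂; swap)
open import Data.Unit using (⊤; tt)
open import Data.Vec using ([]; _∷_)
import Data.Vec as Vec
open import Function using (_∘_; id)
open import Relation.Binary.Definitions using (DecidableEquality)
open import Relation.Binary.PropositionalEquality
open import Relation.Nullary using (Dec; yes; no; ¬_; contradiction)
open import Relation.Nullary.Decidable using (toSum)
open import Relation.Unary using (Pred; Decidable)

-- Filters, counts and sums over lists

module _ {a p q} {A : Set a} {P : Pred A p} {Q : Pred A q} (P? : Decidable P) (Q? : Decidable Q) where

  filter-comm : ∀ xs → filter P? (filter Q? xs) ≡ filter Q? (filter P? xs)
  filter-comm [] = refl
  filter-comm (x ∷ xs) = by-cases (P? x) (Q? x)
    where
    by-cases : Dec (P x) → Dec (Q x) → filter P? (filter Q? (x ∷ xs)) ≡ filter Q? (filter P? (x ∷ xs))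
    by-cases (yes px) (yes qx)
      rewrite filter-accept Q? {xs = xs} qx | filter-accept P? {xs = filter Q? xs} px
            | filter-accept P? {xs = xs} px | filter-accept Q? {xs = filter P? xs} qx
      = cong (x ∷_) (filter-comm xs)
    by-cases (yes px) (no ¬qx)
      rewrite filter-reject Q? {xs = xs} ¬qx | filter-accept P? {xs = xs} px
            | filter-reject Q? {xs = filter P? xs} ¬qx
      = filter-comm xs
    by-cases (no ¬px) (yes qx)
      rewrite filter-accept Q? {xs = xs} qx | filter-reject P? {xs = filter Q? xs} ¬px
            | filter-reject P? {xs = xs} ¬px
      = filter-comm xs
    by-cases (no ¬px) (no ¬qx)
      rewrite filter-reject Q? {xs = xs} ¬qx | filter-reject P? {xs = xs} ¬px
      = filter-comm xs

  length-filter-mono : (∀ {x} → P x → Q x) → ∀ xs → length (filter P? xs) ≤ length (filter Q? xs)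
  length-filter-mono P⇒Q [] = z≤n
  length-filter-mono P⇒Q (x ∷ xs) with P? x | Q? x
  ... | yes _  | yes _  = s≤s (length-filter-mono P⇒Q xs)
  ... | yes px | no ¬qx = contradiction (P⇒Q px) ¬qx
  ... | no _   | yes _  = m≤n⇒m≤1+n (length-filter-mono P⇒Q xs)
  ... | no _   | no _   = length-filter-mono P⇒Q xs

module _ {a p q r} {A : Set a} {P : Pred A p} {Q : Pred A q} {R : Pred A r}
         (P? : Decidable P) (Q? : Decidable Q) (R? : Decidable R) where

  length-filter-⊎ : (∀ {x} → P x → Q x ⊎ R x) → ∀ xs →
    length (filter P? xs) ≤ length (filter Q? xs) + length (filter R? xs)
  length-filter-⊎ P⇒Q⊎R [] = z≤n
  length-filter-⊎ P⇒Q⊎R (x ∷ xs) with ih ← length-filter-⊎ P⇒Q⊎R xs | P? x | Q? x | R? x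
  ... | no _   | no _   | no _  = ih
  ... | no _   | yes _  | no _  = m≤n⇒m≤1+n ih
  ... | no _   | no _   | yes _ = ≤-trans ih (+-monoʳ-≤ _ (n≤1+n _))
  ... | no _   | yes _  | yes _ = m≤n⇒m≤1+n (≤-trans ih (+-monoʳ-≤ _ (n≤1+n _)))
  ... | yes _  | yes _  | no _  = s≤s ih
  ... | yes _  | yes _  | yes _ = s≤s (≤-trans ih (+-monoʳ-≤ _ (n≤1+n _)))
  ... | yes _  | no _   | yes _ = ≤-trans (s≤s ih) (≤-reflexive (sym (+-suc _ _)))
  ... | yes px | no ¬qx | no ¬rx with P⇒Q⊎R px
  ...   | inj₁ qx = contradiction qx ¬qx
  ...   | inj₂ rx = contradiction rx ¬rx

module _ {a} {A : Set a} (_≟_ : DecidableEquality A) where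
  open DecMembership _≟_ using () renaming (_∈?_ to _∈ₗ?_; _∉?_ to _∉ₗ?_)

  Unique⇒length-filter-≡≤1 : ∀ c {xs} → Unique xs → length (filter (_≟ c) xs) ≤ 1
  Unique⇒length-filter-≡≤1 c [] = z≤n
  Unique⇒length-filter-≡≤1 c {x ∷ xs} (x∉xs ∷ u) with x ≟ c
  ... | yes refl rewrite filter-none (_≟ x) (All.map ≢-sym x∉xs) = s≤s z≤n
  ... | no _ = Unique⇒length-filter-≡≤1 c u

  Unique⇒length-filter-∈≤ : ∀ ls {xs} → Unique xs → length (filter (_∈ₗ? ls) xs) ≤ length ls
  Unique⇒length-filter-∈≤ [] {xs} _ rewrite filter-none (_∈ₗ? []) {xs} (All.tabulate λ _ ()) = z≤n
  Unique⇒length-filter-∈≤ (c ∷ ls) {xs} u =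
    ≤-trans (length-filter-⊎ (_∈ₗ? (c ∷ ls)) (_≟ c) (_∈ₗ? ls) here-or-there xs)
            (+-mono-≤ (Unique⇒length-filter-≡≤1 c u) (Unique⇒length-filter-∈≤ ls u))
    where
    here-or-there : ∀ {x} → x ∈ₗ c ∷ ls → x ≡ c ⊎ x ∈ₗ ls
    here-or-there (here x≡c) = inj₁ x≡c
    here-or-there (there x∈ls) = inj₂ x∈ls

  Unique⇒length≤length-filter-∉+length : ∀ ls {xs} → Unique xs → length xs ≤ length (filter (_∉ₗ? ls) xs) + length ls
  Unique⇒length≤length-filter-∉+length ls {xs} u = begin
    length xs                                                 ≡⟨ cong length (sym (filter-all all? {xs} (All.tabulate _))) ⟩
    length (filter all? xs)                                   ≤⟨ length-filter-⊎ all? (_∉ₗ? ls) (_∈ₗ? ls) ∉-or-∈ xs ⟩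
    length (filter (_∉ₗ? ls) xs) + length (filter (_∈ₗ? ls) xs) ≤⟨ +-monoʳ-≤ _ (Unique⇒length-filter-∈≤ ls u) ⟩
    length (filter (_∉ₗ? ls) xs) + length ls                   ∎
    where
    open ≤-Reasoning
    all? : Decidable {A = A} (λ _ → ⊤)
    all? _ = yes tt
    ∉-or-∈ : ∀ {x} → ⊤ → x ∉ₗ ls ⊎ x ∈ₗ ls
    ∉-or-∈ {x} _ = swap (toSum (x ∈ₗ? ls))

Unique⇒AllPairs : ∀ {a r} {A : Set a} {R : A → A → Set r} {xs} →
  (∀ {x y} → x ∈ₗ xs → y ∈ₗ xs → x ≢ y → R x y) → Unique xs → AllPairs R xs
Unique⇒AllPairs R-distinct [] = []
Unique⇒AllPairs R-distinct (x∉xs ∷ xs-unique) =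
  All.tabulate (λ y∈xs → R-distinct (here refl) (there y∈xs) (All.lookup x∉xs y∈xs))
  ∷ Unique⇒AllPairs (λ x∈ y∈ → R-distinct (there x∈) (there y∈)) xs-unique

sum-map-mono-≤ : ∀ {a} {A : Set a} {f g : A → ℕ} → (∀ x → f x ≤ g x) →
                 ∀ xs → sum (map f xs) ≤ sum (map g xs)
sum-map-mono-≤ f≤g [] = z≤n
sum-map-mono-≤ f≤g (x ∷ xs) = +-mono-≤ (f≤g x) (sum-map-mono-≤ f≤g xs)

module _ {a} {A : Set a} (f : A → ℕ) where

  ≤foldr-⊔ : ∀ {x xs} → x ∈ₗ xs → f x ≤ foldr _⊔_ 0 (map f xs)
  ≤foldr-⊔ (here refl) = m≤m⊔n _ _
  ≤foldr-⊔ (there x∈xs) = ≤-trans (≤foldr-⊔ x∈xs) (m≤n⊔m _ _)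

  foldr-⊔≤ : ∀ {b} xs → (∀ x → f x ≤ b) → foldr _⊔_ 0 (map f xs) ≤ b
  foldr-⊔≤ {b} xs f≤b =
    foldr-preservesᵇ {P = _≤ b} ⊔-lub z≤n (Allₚ.map⁺ (All.tabulate {xs = xs} (λ {x} _ → f≤b x)))

module _ {a} {A : Set a} (r : A → ℕ) where

  2#[3≤r]+#[r≡2]+Σ[r∸3]≤Σ[r∸1] : ∀ xs →
    2 * length (filter (λ x → 3 ≤? r x) xs) + length (filter (λ x → r x ≟ 2) xs) + sum (map (λ x → r x ∸ 3) xs)
      ≤ sum (map (λ x → r x ∸ 1) xs)
  2#[3≤r]+#[r≡2]+Σ[r∸3]≤Σ[r∸1] [] = z≤n
  2#[3≤r]+#[r≡2]+Σ[r∸3]≤Σ[r∸1] (x ∷ xs) with r x | 2#[3≤r]+#[r≡2]+Σ[r∸3]≤Σ[r∸1] xs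
  ... | 0 | ih = ih
  ... | 1 | ih = ih
  ... | 2 | ih = ≤-trans (≤-reflexive (shift₂ (length (filter (λ x → 3 ≤? r x) xs)) _ _)) (s≤s ih)
    where
    shift₂ : ∀ a b c → 2 * a + suc b + c ≡ suc (2 * a + b + c)
    shift₂ = solve-∀
  ... | suc (suc (suc k)) | ih =
    ≤-trans (≤-reflexive (shift₃ k (length (filter (λ x → 3 ≤? r x) xs)) _ _)) (+-monoʳ-≤ (2 + k) ih)
    where
    shift₃ : ∀ k a b c → 2 * suc a + b + (k + c) ≡ 2 + k + (2 * a + b + c)
    shift₃ = solve-∀

module _ {a} {A : Set a} (r : A → ℕ) (w : ℕ → ℕ) where

  weighted-count : List ℕ → List A → ℕ
  weighted-count ks xs = sum (map (λ k → w k * length (filter (λ x → k ≟ r x) xs)) ks)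

  weighted-count-[] : ∀ ks → weighted-count ks [] ≡ 0
  weighted-count-[] [] = refl
  weighted-count-[] (k ∷ ks) = cong₂ _+_ (*-zeroʳ (w k)) (weighted-count-[] ks)

  weighted-count-∉ : ∀ {x} xs {ks} → All (_≢ r x) ks → weighted-count ks (x ∷ xs) ≡ weighted-count ks xs
  weighted-count-∉ xs ks≢rx = cong sum (map-cong-local
    (All.map (λ {k} k≢rx → cong (λ ys → w k * length ys) (filter-reject (λ y → k ≟ r y) k≢rx)) ks≢rx))

  weighted-count-∷ : ∀ x xs {ks} → Unique ks → weighted-count ks (x ∷ xs) ≤ w (r x) + weighted-count ks xs
  weighted-count-∷ x xs [] = z≤n
  weighted-count-∷ x xs {k ∷ ks} (k∉ks ∷ ks-unique) with k ≟ r x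
  ... | yes refl rewrite filter-accept (λ y → r x ≟ r y) {x} {xs} refl = ≤-reflexive (begin
    w (r x) * suc c + weighted-count ks (x ∷ xs)
      ≡⟨ cong₂ _+_ (*-suc (w (r x)) c) (weighted-count-∉ xs (All.map ≢-sym k∉ks)) ⟩
    w (r x) + w (r x) * c + weighted-count ks xs
      ≡⟨ +-assoc (w (r x)) _ _ ⟩
    w (r x) + (w (r x) * c + weighted-count ks xs) ∎)
    where
    open ≡-Reasoning
    c = length (filter (λ y → r x ≟ r y) xs)
  ... | no k≢rx rewrite filter-reject (λ y → k ≟ r y) {x} {xs} k≢rx =
    ≤-trans (+-monoʳ-≤ (w k * c) (weighted-count-∷ x xs ks-unique)) (≤-reflexive (x∙yz≈y∙xz (w k * c) (w (r x)) _))
    where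
    c = length (filter (λ y → k ≟ r y) xs)

  weighted-count≤Σw : ∀ {ks} → Unique ks → ∀ xs → weighted-count ks xs ≤ sum (map (w ∘ r) xs)
  weighted-count≤Σw {ks} _ [] = ≤-reflexive (weighted-count-[] ks)
  weighted-count≤Σw ks-unique (x ∷ xs) =
    ≤-trans (weighted-count-∷ x xs ks-unique) (+-monoʳ-≤ (w (r x)) (weighted-count≤Σw ks-unique xs))

-- Cardinalities of subsets of Fin n

∣p∪q∣+∣p∩q∣≡∣p∣+∣q∣ : ∀ {n} (p q : Subset n) → ∣ p ∪ q ∣ + ∣ p ∩ q ∣ ≡ ∣ p ∣ + ∣ q ∣
∣p∪q∣+∣p∩q∣≡∣p∣+∣q∣ [] [] = refl
∣p∪q∣+∣p∩q∣≡∣p∣+∣q∣ (outside ∷ p) (outside ∷ q) = ∣p∪q∣+∣p∩q∣≡∣p∣+∣q∣ p q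
∣p∪q∣+∣p∩q∣≡∣p∣+∣q∣ (inside ∷ p) (outside ∷ q) = cong suc (∣p∪q∣+∣p∩q∣≡∣p∣+∣q∣ p q)
∣p∪q∣+∣p∩q∣≡∣p∣+∣q∣ (outside ∷ p) (inside ∷ q) =
  trans (cong suc (∣p∪q∣+∣p∩q∣≡∣p∣+∣q∣ p q)) (sym (+-suc ∣ p ∣ ∣ q ∣))
∣p∪q∣+∣p∩q∣≡∣p∣+∣q∣ (inside ∷ p) (inside ∷ q) =
  trans (cong suc (+-suc ∣ p ∪ q ∣ ∣ p ∩ q ∣))
        (cong suc (trans (cong suc (∣p∪q∣+∣p∩q∣≡∣p∣+∣q∣ p q)) (sym (+-suc ∣ p ∣ ∣ q ∣))))

∣p∪q∣≤∣p∣+∣q∣ : ∀ {n} (p q : Subset n) → ∣ p ∪ q ∣ ≤ ∣ p ∣ + ∣ q ∣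
∣p∪q∣≤∣p∣+∣q∣ p q = ≤-trans (m≤m+n ∣ p ∪ q ∣ ∣ p ∩ q ∣) (≤-reflexive (∣p∪q∣+∣p∩q∣≡∣p∣+∣q∣ p q))

Empty⇒∣p∣≡0 : ∀ {n} {p : Subset n} → Empty p → ∣ p ∣ ≡ 0
Empty⇒∣p∣≡0 {n} p-empty = trans (cong ∣_∣ (Empty-unique p-empty)) (∣⊥∣≡0 n)

Disjoint⇒∣p∪q∣≡∣p∣+∣q∣ : ∀ {n} {p q : Subset n} → Disjoint p q → ∣ p ∪ q ∣ ≡ ∣ p ∣ + ∣ q ∣
Disjoint⇒∣p∪q∣≡∣p∣+∣q∣ {p = p} {q} p#q = begin
  ∣ p ∪ q ∣             ≡⟨ sym (+-identityʳ _) ⟩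
  ∣ p ∪ q ∣ + 0         ≡⟨ cong (∣ p ∪ q ∣ +_) (sym (Empty⇒∣p∣≡0 p∩q-empty)) ⟩
  ∣ p ∪ q ∣ + ∣ p ∩ q ∣ ≡⟨ ∣p∪q∣+∣p∩q∣≡∣p∣+∣q∣ p q ⟩
  ∣ p ∣ + ∣ q ∣         ∎
  where
  open ≡-Reasoning
  p∩q-empty : Empty (p ∩ q)
  p∩q-empty (x , x∈p∩q) with x∈p∩q⁻ p q x∈p∩q
  ... | x∈p , x∈q = p#q x x∈p x∈q

x∈p⇒0<∣p∣ : ∀ {n} {x : Fin n} {p} → x ∈ p → 0 < ∣ p ∣
x∈p⇒0<∣p∣ {x = x} x∈p = ≤-trans (≤-reflexive (sym (∣⁅x⁆∣≡1 x))) (p⊆q⇒∣p∣≤∣q∣ ⁅x⁆⊆p)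
  where
  ⁅x⁆⊆p : ⁅ x ⁆ ⊆ _
  ⁅x⁆⊆p y∈⁅x⁆ = subst (_∈ _) (sym (x∈⁅y⁆⇒x≡y x y∈⁅x⁆)) x∈p

0<∣p∣⇒Nonempty : ∀ {n} {p : Subset n} → 0 < ∣ p ∣ → Nonempty p
0<∣p∣⇒Nonempty {p = p} 0<∣p∣ with nonempty? p
... | yes ne = ne
... | no ¬ne = contradiction (Empty⇒∣p∣≡0 ¬ne) (>⇒≢ 0<∣p∣)

x∈p─q⇒x∉q : ∀ {n} {x : Fin n} (p q : Subset n) → x ∈ p ─ q → x ∉ q
x∈p─q⇒x∉q (inside ∷ p) (outside ∷ q) Vec.here ()
x∈p─q⇒x∉q (s ∷ p) (t ∷ q) (Vec.there x∈p─q) (Vec.there x∈q) = x∈p─q⇒x∉q p q x∈p─q x∈q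

∣p∣≤1+∣p-x∣ : ∀ {n} (p : Subset n) x → ∣ p ∣ ≤ 1 + ∣ p - x ∣
∣p∣≤1+∣p-x∣ p x = begin
  ∣ p ∣                 ≤⟨ p⊆q⇒∣p∣≤∣q∣ p⊆⁅x⁆∪p-x ⟩
  ∣ ⁅ x ⁆ ∪ (p - x) ∣   ≤⟨ ∣p∪q∣≤∣p∣+∣q∣ ⁅ x ⁆ (p - x) ⟩
  ∣ ⁅ x ⁆ ∣ + ∣ p - x ∣ ≡⟨ cong (_+ ∣ p - x ∣) (∣⁅x⁆∣≡1 x) ⟩
  1 + ∣ p - x ∣         ∎
  where
  open ≤-Reasoning
  p⊆⁅x⁆∪p-x : p ⊆ ⁅ x ⁆ ∪ (p - x)
  p⊆⁅x⁆∪p-x {y} y∈p with y Finₚ.≟ x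
  ... | yes refl = x∈p∪q⁺ (inj₁ (x∈⁅x⁆ x))
  ... | no y≢x   = x∈p∪q⁺ (inj₂ (x∈p∧x≢y⇒x∈p-y y∈p y≢x))

x∈p-y⇒x≢y : ∀ {n} {x y : Fin n} (p : Subset n) → x ∈ p - y → x ≢ y
x∈p-y⇒x≢y {x = x} p x∈p-y refl = x∈p─q⇒x∉q p ⁅ x ⁆ x∈p-y (x∈⁅x⁆ x)

∣p∣≤1⇒x≡y : ∀ {n} {p : Subset n} {x y} → ∣ p ∣ ≤ 1 → x ∈ p → y ∈ p → x ≡ y
∣p∣≤1⇒x≡y {p = p} {x} {y} ∣p∣≤1 x∈p y∈p with x Finₚ.≟ y
... | yes x≡y = x≡y
... | no x≢y  =
  contradiction (≤-trans (x∈p⇒∣p-x∣<∣p∣ {p = p} y∈p) ∣p∣≤1) (<⇒≱ (s≤s (x∈p⇒0<∣p∣ x∈p-y)))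
  where
  x∈p-y : x ∈ p - y
  x∈p-y = x∈p∧x≢y⇒x∈p-y x∈p x≢y

∣p∣≡2⇒⊆pair : ∀ {n} {p : Subset n} → ∣ p ∣ ≡ 2 → ∃₂ λ x y → ∀ {w} → w ∈ p → w ≡ x ⊎ w ≡ y
∣p∣≡2⇒⊆pair {p = p} ∣p∣≡2 with 0<∣p∣⇒Nonempty (≤-trans (s≤s z≤n) (≤-reflexive (sym ∣p∣≡2)))
... | x , x∈p
  with 0<∣p∣⇒Nonempty {p = p - x} (+-cancelˡ-≤ 1 1 _ (≤-trans (≤-reflexive (sym ∣p∣≡2)) (∣p∣≤1+∣p-x∣ p x)))
... | y , y∈p-x = x , y , x-or-y
  where
  ∣p-x∣≤1 : ∣ p - x ∣ ≤ 1
  ∣p-x∣≤1 = ≤-pred (≤-trans (x∈p⇒∣p-x∣<∣p∣ {p = p} x∈p) (≤-reflexive ∣p∣≡2))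
  x-or-y : ∀ {w} → w ∈ p → w ≡ x ⊎ w ≡ y
  x-or-y {w} w∈p with w Finₚ.≟ x
  ... | yes w≡x = inj₁ w≡x
  ... | no w≢x  = inj₂ (∣p∣≤1⇒x≡y ∣p-x∣≤1 (x∈p∧x≢y⇒x∈p-y w∈p w≢x) y∈p-x)

x∈⋃⁻ : ∀ {n} {x : Fin n} ps → x ∈ ⋃ ps → Any (x ∈_) ps
x∈⋃⁻ [] x∈∅ = contradiction x∈∅ ∉⊥
x∈⋃⁻ (p ∷ ps) x∈p∪⋃ps with x∈p∪q⁻ p (⋃ ps) x∈p∪⋃ps
... | inj₁ x∈p    = here x∈p
... | inj₂ x∈⋃ps = there (x∈⋃⁻ ps x∈⋃ps)

Disjoint⇒Σ∣p∣≡∣⋃p∣ : ∀ {n} (ps : List (Subset n)) → AllPairs Disjoint ps → sum (map ∣_∣ ps) ≡ ∣ ⋃ ps ∣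
Disjoint⇒Σ∣p∣≡∣⋃p∣ {n} [] [] = sym (∣⊥∣≡0 n)
Disjoint⇒Σ∣p∣≡∣⋃p∣ (p ∷ ps) (p#ps ∷ ps-disjoint) = begin
  ∣ p ∣ + sum (map ∣_∣ ps) ≡⟨ cong (∣ p ∣ +_) (Disjoint⇒Σ∣p∣≡∣⋃p∣ ps ps-disjoint) ⟩
  ∣ p ∣ + ∣ ⋃ ps ∣         ≡⟨ sym (Disjoint⇒∣p∪q∣≡∣p∣+∣q∣ p#⋃ps) ⟩
  ∣ p ∪ ⋃ ps ∣             ∎
  where
  open ≡-Reasoning
  p#⋃ps : Disjoint p (⋃ ps)
  p#⋃ps x x∈p x∈⋃ps = All.lookupWith (λ p#q x∈q → p#q x x∈p x∈q) p#ps (x∈⋃⁻ ps x∈⋃ps)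

module _ {n} (z : Fin n) where

  ⁅z⁆#p-z : ∀ p → Disjoint ⁅ z ⁆ (p - z)
  ⁅z⁆#p-z p w w∈⁅z⁆ w∈p-z = x∈p-y⇒x≢y p w∈p-z (x∈⁅y⁆⇒x≡y z w∈⁅z⁆)

  p-z#q-z : ∀ {p q} → z ∈ p → z ∈ q → ∣ p ∩ q ∣ ≤ 1 → Disjoint (p - z) (q - z)
  p-z#q-z {p} {q} z∈p z∈q ∣p∩q∣≤1 w w∈p-z w∈q-z =
    x∈p-y⇒x≢y p w∈p-z (∣p∣≤1⇒x≡y ∣p∩q∣≤1 w∈p∩q (x∈p∩q⁺ (z∈p , z∈q)))
    where
    w∈p∩q = x∈p∩q⁺ (p─q⊆p p ⁅ z ⁆ w∈p-z , p─q⊆p q ⁅ z ⁆ w∈q-z)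

  punctured-disjoint : ∀ {ps} → All (z ∈_) ps → AllPairs (λ p q → ∣ p ∩ q ∣ ≤ 1) ps →
    AllPairs (λ p q → Disjoint (p - z) (q - z)) ps
  punctured-disjoint [] [] = []
  punctured-disjoint (z∈p ∷ z∈ps) (p-meets ∷ ps-meet) =
    All.zipWith (λ (z∈q , ∣p∩q∣≤1) → p-z#q-z z∈p z∈q ∣p∩q∣≤1) (z∈ps , p-meets) ∷ punctured-disjoint z∈ps ps-meet

  linear-star⇒Σ[∣p∣∸1]<n : ∀ ps → All (z ∈_) ps → AllPairs (λ p q → ∣ p ∩ q ∣ ≤ 1) ps →
    sum (map (λ p → ∣ p ∣ ∸ 1) ps) < n
  linear-star⇒Σ[∣p∣∸1]<n ps z∈ps ps-meet = begin-strict
    sum (map (λ p → ∣ p ∣ ∸ 1) ps)         ≤⟨ sum-map-mono-≤ (λ p → m≤n+o⇒m∸n≤o ∣ p ∣ 1 (∣p∣≤1+∣p-x∣ p z)) ps ⟩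
    sum (map (λ p → ∣ p - z ∣) ps)         ≡⟨ cong sum (map-∘ ps) ⟩
    sum (map ∣_∣ (map (_- z) ps))          <⟨ ≤-reflexive (cong (_+ sum (map ∣_∣ (map (_- z) ps))) (sym (∣⁅x⁆∣≡1 z))) ⟩
    sum (map ∣_∣ (⁅ z ⁆ ∷ map (_- z) ps))  ≡⟨ Disjoint⇒Σ∣p∣≡∣⋃p∣ _ family-disjoint ⟩
    ∣ ⋃ (⁅ z ⁆ ∷ map (_- z) ps) ∣          ≤⟨ ∣p∣≤n (⋃ (⁅ z ⁆ ∷ map (_- z) ps)) ⟩
    n                                      ∎
    where
    open ≤-Reasoning
    family-disjoint : AllPairs Disjoint (⁅ z ⁆ ∷ map (_- z) ps)
    family-disjoint = Allₚ.map⁺ (All.tabulate (λ {p} _ → ⁅z⁆#p-z p))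
                    ∷ AllPairsₚ.map⁺ (punctured-disjoint z∈ps ps-meet)

-- Degrees in hypergraphs

degree≤maxDegree : ∀ {n} (E : Hypergraph n) x → degree E x ≤ maxDegree E
degree≤maxDegree E x = ≤foldr-⊔ (degree E) (∈-allFin x)

maxDegree≤ : ∀ {n} (E : Hypergraph n) {b} → (∀ x → degree E x ≤ b) → maxDegree E ≤ b
maxDegree≤ {n} E = foldr-⊔≤ (degree E) (allFin n)

meets? : ∀ {n} (e f : Subset n) → Dec (Nonempty (e ∩ f))
meets? e f = nonempty? (e ∩ f)

∩-sym-Nonempty : ∀ {n} {e f : Subset n} → Nonempty (e ∩ f) → Nonempty (f ∩ e)
∩-sym-Nonempty {e = e} {f} (x , x∈e∩f) with x∈p∩q⁻ e f x∈e∩f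
... | x∈e , x∈f = x , x∈p∩q⁺ (x∈f , x∈e)

meeting⇒¬Disjoint : ∀ {n} {e f : Subset n} → Nonempty (e ∩ f) → ¬ Disjoint e f
meeting⇒¬Disjoint {e = e} {f} (x , x∈e∩f) e#f = uncurry (e#f x) (x∈p∩q⁻ e f x∈e∩f)

rank0⇒disjoint : ∀ {n} {e f : Subset n} → rank e ≡ 0 → ¬ Nonempty (e ∩ f)
rank0⇒disjoint {e = e} {f} rank≡0 (x , x∈e∩f) =
  <⇒≢ (x∈p⇒0<∣p∣ (proj₁ (x∈p∩q⁻ e f x∈e∩f))) (sym rank≡0)

rank1-meeting⇒≡ : ∀ {n} {e f : Subset n} → rank e ≡ 1 → rank f ≡ 1 → Nonempty (e ∩ f) → e ≡ f
rank1-meeting⇒≡ {e = e} {f} rank-e≡1 rank-f≡1 (x , x∈e∩f) with x∈p∩q⁻ e f x∈e∩f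
... | x∈e , x∈f = ⊆-antisym (⊆-via-x rank-e≡1 x∈e x∈f) (⊆-via-x rank-f≡1 x∈f x∈e)
  where
  ⊆-via-x : ∀ {p q : Subset _} {x} → rank p ≡ 1 → x ∈ p → x ∈ q → p ⊆ q
  ⊆-via-x {q = q} rank≡1 x∈p x∈q w∈p = subst (_∈ q) (∣p∣≤1⇒x≡y (≤-reflexive rank≡1) x∈p w∈p) x∈q

length-meeting-rank1≤degree : ∀ {n} (F : Hypergraph n) {e x} → rank e ≡ 1 → x ∈ e →
  length (filter (meets? e) F) ≤ degree F x
length-meeting-rank1≤degree F {e} {x} rank≡1 x∈e = length-filter-mono (meets? e) (x ∈?_) through-x F
  where
  through-x : ∀ {f} → Nonempty (e ∩ f) → x ∈ f
  through-x {f} (w , w∈e∩f) with x∈p∩q⁻ e f w∈e∩f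
  ... | w∈e , w∈f = subst (_∈ f) (∣p∣≤1⇒x≡y (≤-reflexive rank≡1) w∈e x∈e) w∈f

length-meeting-rank2≤2maxDegree : ∀ {n} (F : Hypergraph n) {e} → rank e ≡ 2 →
  length (filter (meets? e) F) ≤ 2 * maxDegree F
length-meeting-rank2≤2maxDegree F {e} rank≡2 with ∣p∣≡2⇒⊆pair rank≡2
... | x , y , e⊆xy = begin
  length (filter (meets? e) F)                      ≤⟨ length-filter-⊎ (meets? e) (x ∈?_) (y ∈?_) through-x-or-y F ⟩
  degree F x + degree F y                           ≤⟨ +-mono-≤ (degree≤maxDegree F x) (degree≤maxDegree F y) ⟩
  maxDegree F + maxDegree F                         ≡⟨ cong (maxDegree F +_) (sym (+-identityʳ _)) ⟩
  2 * maxDegree F                                   ∎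
  where
  open ≤-Reasoning
  through-x-or-y : ∀ {f} → Nonempty (e ∩ f) → x ∈ f ⊎ y ∈ f
  through-x-or-y {f} (w , w∈e∩f) with x∈p∩q⁻ e f w∈e∩f
  ... | w∈e , w∈f with e⊆xy w∈e
  ...   | inj₁ refl = inj₁ w∈f
  ...   | inj₂ refl = inj₂ w∈f

module _ {n : ℕ} where
  open DecMembership (Finₚ._≟_ {n}) using () renaming (_∉?_ to _∉ᶜ?_)

  free : List (Fin n) → List (Fin n)
  free cs = filter (_∉ᶜ? cs) (allFin n)

  ∈free⇒∉ : ∀ {c} cs → c ∈ₗ free cs → c ∉ₗ cs
  ∈free⇒∉ cs c∈free = proj₂ (∈-filter⁻ (_∉ᶜ? cs) {xs = allFin n} c∈free)

  n≤length-free+length : ∀ cs → n ≤ length (free cs) + length cs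
  n≤length-free+length cs =
    subst (_≤ length (free cs) + length cs) (length-tabulate {n = n} id)
          (Unique⇒length≤length-filter-∉+length Finₚ._≟_ cs {allFin n} (Uniqueₚ.allFin⁺ n))

-- The extension

module Extension
  (list-colouring : ListEdgeColoringConjecture)
  {n} (E : Hypergraph n) (E-unique : IsHypergraph E) (E-linear : Linear E)
  (excess-large : ∀ x → 2 * (maxDegree (H₃ E) ∸ degree (H₃ E) x) ≤ excess E x)
  (γ : Subset n → Fin n) (γ-proper : IsEdgeColoring (H₃ E) γ)
  where

  H G : Hypergraph n
  H = H₃ E
  G = filter (λ e → rank e ≟ 2) E

  Δ : ℕ
  Δ = maxDegree H

  star : Fin n → List (Subset n)
  star z = filter (z ∈?_) E

  degree-filter : ∀ {p} {P : Pred (Subset n) p} (P? : Decidable P) z →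
    degree (filter P? E) z ≡ length (filter P? (star z))
  degree-filter P? z = cong length (filter-comm (z ∈?_) P? E)

  excess≤Σ[rank∸3] : ∀ z → excess E z ≤ sum (map (λ e → rank e ∸ 3) (star z))
  excess≤Σ[rank∸3] z = begin
    excess E z
      ≡⟨ cong sum (map-cong-local (All.tabulate {xs = ranks} λ {k} _ →
           cong ((k ∸ 3) *_) (degree-filter (λ e → k ≟ rank e) z))) ⟩
    sum (map (λ k → (k ∸ 3) * length (filter (λ e → k ≟ rank e) (star z))) ranks)
      ≤⟨ weighted-count≤Σw rank (_∸ 3) ranks-unique (star z) ⟩
    sum (map (λ e → rank e ∸ 3) (star z)) ∎
    where
    open ≤-Reasoning
    ranks = filter (4 ≤?_) (upTo (n + 1))
    ranks-unique : Unique ranks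
    ranks-unique = Uniqueₚ.filter⁺ (4 ≤?_) (Uniqueₚ.upTo⁺ (n + 1))

  star-linear : ∀ z → AllPairs (λ e f → ∣ e ∩ f ∣ ≤ 1) (star z)
  star-linear z = Unique⇒AllPairs (λ e∈ f∈ → E-linear _ _ (∈E e∈) (∈E f∈)) (Uniqueₚ.filter⁺ (z ∈?_) E-unique)
    where
    ∈E : ∀ {e} → e ∈ₗ star z → e ∈ₗ E
    ∈E e∈star = proj₁ (∈-filter⁻ (z ∈?_) e∈star)

  2degree-H+degree-G+excess<n : ∀ z → 2 * degree H z + degree G z + excess E z < n
  2degree-H+degree-G+excess<n z = begin-strict
    2 * degree H z + degree G z + excess E z
      ≤⟨ +-monoʳ-≤ (2 * degree H z + degree G z) (excess≤Σ[rank∸3] z) ⟩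
    2 * degree H z + degree G z + sum (map (λ e → rank e ∸ 3) (star z))
      ≡⟨ cong₂ (λ d g → 2 * d + g + sum (map (λ e → rank e ∸ 3) (star z)))
               (degree-filter (λ e → 3 ≤? rank e) z) (degree-filter (λ e → rank e ≟ 2) z) ⟩
    2 * length (filter (λ e → 3 ≤? rank e) (star z)) + length (filter (λ e → rank e ≟ 2) (star z))
      + sum (map (λ e → rank e ∸ 3) (star z))
      ≤⟨ 2#[3≤r]+#[r≡2]+Σ[r∸3]≤Σ[r∸1] rank (star z) ⟩
    sum (map (λ e → rank e ∸ 1) (star z))
      <⟨ linear-star⇒Σ[∣p∣∸1]<n z (star z) (Allₚ.all-filter (z ∈?_) E) (star-linear z) ⟩
    n ∎
    where open ≤-Reasoning

  2Δ≤2degree+excess : ∀ z → 2 * Δ ≤ 2 * degree H z + excess E z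
  2Δ≤2degree+excess z = begin
    2 * Δ                                ≡⟨ cong (2 *_) (sym (m+[n∸m]≡n (degree≤maxDegree H z))) ⟩
    2 * (degree H z + (Δ ∸ degree H z))  ≡⟨ *-distribˡ-+ 2 (degree H z) _ ⟩
    2 * degree H z + 2 * (Δ ∸ degree H z) ≤⟨ +-monoʳ-≤ (2 * degree H z) (excess-large z) ⟩
    2 * degree H z + excess E z          ∎
    where open ≤-Reasoning

  degree-G+2Δ<n : ∀ z → degree G z + 2 * Δ < n
  degree-G+2Δ<n z = begin-strict
    degree G z + 2 * Δ                          ≤⟨ +-monoʳ-≤ (degree G z) (2Δ≤2degree+excess z) ⟩
    degree G z + (2 * degree H z + excess E z)  ≡⟨ x∙yz≈y∙xz (degree G z) (2 * degree H z) (excess E z) ⟩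
    2 * degree H z + (degree G z + excess E z)  ≡⟨ +-assoc (2 * degree H z) (degree G z) (excess E z) ⟨
    2 * degree H z + degree G z + excess E z    <⟨ 2degree-H+degree-G+excess<n z ⟩
    n                                           ∎
    where open ≤-Reasoning

  degree-H+degree-G<n : ∀ z → degree H z + degree G z < n
  degree-H+degree-G<n z = ≤-trans (s≤s (+-monoˡ-≤ (degree G z) (m≤m+n (degree H z) _)))
    (≤-trans (s≤s (m≤m+n _ (excess E z))) (2degree-H+degree-G+excess<n z))

  -- The vertex argument is needed: for n = 0 the inequality is false.
  maxDegree-G+2Δ<n : Fin n → maxDegree G + 2 * Δ < n
  maxDegree-G+2Δ<n z =
    subst (_≤ n) (+-suc (maxDegree G) (2 * Δ)) (m≤o∸n⇒m+n≤o (maxDegree G) 2Δ<n maxDegree-G≤n∸[1+2Δ])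
    where
    2Δ<n : 2 * Δ < n
    2Δ<n = ≤-trans (s≤s (m≤n+m (2 * Δ) (degree G z))) (degree-G+2Δ<n z)
    maxDegree-G≤n∸[1+2Δ] : maxDegree G ≤ n ∸ suc (2 * Δ)
    maxDegree-G≤n∸[1+2Δ] = maxDegree≤ G λ x →
      m+n≤o⇒m≤o∸n (degree G x) (subst (_≤ n) (sym (+-suc (degree G x) (2 * Δ))) (degree-G+2Δ<n x))

  -- Junk value for inputs where no choice is needed; Fin n has no canonical element.
  default : Fin n
  default = γ ∅

  first-free : List (Fin n) → Fin n
  first-free cs with free cs
  ... | []    = default
  ... | c ∷ _ = c

  first-free-∉ : ∀ cs → length cs < n → first-free cs ∉ₗ cs
  first-free-∉ cs |cs|<n with free cs | n≤length-free+length cs | (λ {c} → ∈free⇒∉ {c = c} cs)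
  ... | []    | n≤|cs| | _     = contradiction n≤|cs| (<⇒≱ |cs|<n)
  ... | c ∷ _ | _      | ∈⇒∉ = ∈⇒∉ (here refl)

  H-colours : Subset n → List (Fin n)
  H-colours e = map γ (filter (meets? e) H)

  G-simple : IsSimpleGraph G
  G-simple = Uniqueₚ.filter⁺ (λ e → rank e ≟ 2) E-unique , Allₚ.all-filter (λ e → rank e ≟ 2) E

  G-list-colourable : QListAtMost G (maxDegree G + 1)
  G-list-colourable = list-colouring n G G-simple

  j : ℕ
  j = proj₁ G-list-colourable

  j≤maxDegree-G+1 : j ≤ maxDegree G + 1
  j≤maxDegree-G+1 = proj₁ (proj₂ G-list-colourable)

  palette : Subset n → List (Fin n)
  palette e = take j (free (H-colours e))

  j≤length-free : ∀ {e} → e ∈ₗ G → j ≤ length (free (H-colours e))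
  j≤length-free {e} e∈G = +-cancelʳ-≤ (length (H-colours e)) j _ (begin
    j + length (H-colours e)   ≤⟨ +-mono-≤ j≤maxDegree-G+1 length-H-colours ⟩
    maxDegree G + 1 + 2 * Δ    ≡⟨ +-assoc (maxDegree G) 1 (2 * Δ) ⟩
    maxDegree G + suc (2 * Δ)  ≡⟨ +-suc (maxDegree G) (2 * Δ) ⟩
    suc (maxDegree G + 2 * Δ)  ≤⟨ maxDegree-G+2Δ<n (proj₁ e-nonempty) ⟩
    n                          ≤⟨ n≤length-free+length (H-colours e) ⟩
    length (free (H-colours e)) + length (H-colours e) ∎)
    where
    open ≤-Reasoning
    rank≡2 : rank e ≡ 2
    rank≡2 = proj₂ (∈-filter⁻ (λ e → rank e ≟ 2) {xs = E} e∈G)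
    e-nonempty : Nonempty e
    e-nonempty = 0<∣p∣⇒Nonempty (≤-trans (s≤s z≤n) (≤-reflexive (sym rank≡2)))
    length-H-colours : length (H-colours e) ≤ 2 * Δ
    length-H-colours =
      ≤-trans (≤-reflexive (length-map γ (filter (meets? e) H))) (length-meeting-rank2≤2maxDegree H {e} rank≡2)

  palettes-fit : ∀ e → e ∈ₗ G → length (map toℕ (palette e)) ≡ j × Unique (map toℕ (palette e))
  palettes-fit e e∈G =
    trans (length-map toℕ (palette e)) (trans (length-take j _) (m≤n⇒m⊓n≡m (j≤length-free e∈G))) ,
    Uniqueₚ.map⁺ Finₚ.toℕ-injective (Uniqueₚ.take⁺ j (Uniqueₚ.filter⁺ _ (Uniqueₚ.allFin⁺ n)))

  G-coloured : Σ (Subset n → ℕ) λ φ → (∀ e → e ∈ₗ G → φ e ∈ₗ map toℕ (palette e)) × IsEdgeColoring G φ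
  G-coloured = proj₂ (proj₂ G-list-colourable) (map toℕ ∘ palette) palettes-fit

  φ : Subset n → ℕ
  φ = proj₁ G-coloured

  -- The list-colouring hypothesis is about lists of naturals, so palettes are passed
  -- through toℕ and the chosen colours read back with toColour.
  toColour : ℕ → Fin n
  toColour c with c <? n
  ... | yes c<n = fromℕ< c<n
  ... | no _    = default

  toColour-toℕ : ∀ c → toColour (toℕ c) ≡ c
  toColour-toℕ c with toℕ c <? n
  ... | yes c<n = Finₚ.fromℕ<-toℕ c c<n
  ... | no c≮n  = contradiction (Finₚ.toℕ<n c) c≮n

  colour₂ : Subset n → Fin n
  colour₂ e = toColour (φ e)

  colour₂∈palette : ∀ {e} → e ∈ₗ G → colour₂ e ∈ₗ palette e × φ e ≡ toℕ (colour₂ e)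
  colour₂∈palette {e} e∈G = from-witness (∈-map⁻ toℕ (proj₁ (proj₂ G-coloured) e e∈G))
    where
    Chosen : Fin n → Set
    Chosen c = c ∈ₗ palette e × φ e ≡ toℕ c
    from-witness : Σ (Fin n) Chosen → Chosen (colour₂ e)
    from-witness (c , chosen@(_ , φe≡c)) =
      subst Chosen (sym (trans (cong toColour φe≡c) (toColour-toℕ c))) chosen

  colour₂∉H-colours : ∀ {e} → e ∈ₗ G → colour₂ e ∉ₗ H-colours e
  colour₂∉H-colours {e} e∈G =
    ∈free⇒∉ (H-colours e) (Any-resp-⊆ (take-⊆ j (free (H-colours e))) (proj₁ (colour₂∈palette e∈G)))

  colour₂-proper : IsEdgeColoring G colour₂
  colour₂-proper e f e∈G f∈G e≢f same-colour = proj₂ (proj₂ G-coloured) e f e∈G f∈G e≢f (begin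
    φ e             ≡⟨ proj₂ (colour₂∈palette e∈G) ⟩
    toℕ (colour₂ e) ≡⟨ cong toℕ same-colour ⟩
    toℕ (colour₂ f) ≡⟨ proj₂ (colour₂∈palette f∈G) ⟨
    φ f             ∎)
    where open ≡-Reasoning

  neighbour-colours : Subset n → List (Fin n)
  neighbour-colours e = H-colours e ++ map colour₂ (filter (meets? e) G)

  colour₁ : Subset n → Fin n
  colour₁ e = first-free (neighbour-colours e)

  colour₁∉neighbour-colours : ∀ {e} → rank e ≡ 1 → colour₁ e ∉ₗ neighbour-colours e
  colour₁∉neighbour-colours {e} rank≡1 =
    first-free-∉ (neighbour-colours e) (few-neighbours (0<∣p∣⇒Nonempty (≤-reflexive (sym rank≡1))))
    where
    open ≤-Reasoning
    few-neighbours : Nonempty e → length (neighbour-colours e) < n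
    few-neighbours (x , x∈e) = begin-strict
        length (neighbour-colours e)
          ≡⟨ length-++ (H-colours e) ⟩
        length (H-colours e) + length (map colour₂ (filter (meets? e) G))
          ≡⟨ cong₂ _+_ (length-map γ (filter (meets? e) H)) (length-map colour₂ (filter (meets? e) G)) ⟩
        length (filter (meets? e) H) + length (filter (meets? e) G)
          ≤⟨ +-mono-≤ (length-meeting-rank1≤degree H rank≡1 x∈e) (length-meeting-rank1≤degree G rank≡1 x∈e) ⟩
        degree H x + degree G x
          <⟨ degree-H+degree-G<n x ⟩
        n ∎

  -- Edges of rank 0 meet nothing, so their colour is irrelevant.
  colour : Subset n → ℕ → Fin n
  colour e 1 = colour₁ e
  colour e 2 = colour₂ e
  colour e _ = γ e

  δ : Subset n → Fin n
  δ e = colour e (rank e)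

  ∈H : ∀ {f k} → f ∈ₗ E → rank f ≡ 3 + k → f ∈ₗ H
  ∈H f∈E rank≡3+k = ∈-filter⁺ (λ e → 3 ≤? rank e) f∈E (subst (3 ≤_) (sym rank≡3+k) (m≤m+n 3 _))

  ∈G : ∀ {f} → f ∈ₗ E → rank f ≡ 2 → f ∈ₗ G
  ∈G f∈E rank≡2 = ∈-filter⁺ (λ e → rank e ≟ 2) f∈E rank≡2

  H-colour∈ : ∀ {e f} → f ∈ₗ H → Nonempty (e ∩ f) → γ f ∈ₗ H-colours e
  H-colour∈ {e} f∈H e∩f = ∈-map⁺ γ (∈-filter⁺ (meets? e) f∈H e∩f)

  G-colour∈ : ∀ {e f} → f ∈ₗ G → Nonempty (e ∩ f) → colour₂ f ∈ₗ neighbour-colours e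
  G-colour∈ {e} f∈G e∩f = ∈-++⁺ʳ (H-colours e) (∈-map⁺ colour₂ (∈-filter⁺ (meets? e) f∈G e∩f))

  colour₁-avoids-H : ∀ {e f} → rank e ≡ 1 → f ∈ₗ H → Nonempty (e ∩ f) → colour₁ e ≢ γ f
  colour₁-avoids-H {e} rank≡1 f∈H e∩f same =
    colour₁∉neighbour-colours rank≡1 (subst (_∈ₗ neighbour-colours e) (sym same) (∈-++⁺ˡ (H-colour∈ f∈H e∩f)))

  colour₁-avoids-G : ∀ {e f} → rank e ≡ 1 → f ∈ₗ G → Nonempty (e ∩ f) → colour₁ e ≢ colour₂ f
  colour₁-avoids-G {e} rank≡1 f∈G e∩f same =
    colour₁∉neighbour-colours rank≡1 (subst (_∈ₗ neighbour-colours e) (sym same) (G-colour∈ f∈G e∩f))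

  colour₂-avoids-H : ∀ {e f} → e ∈ₗ G → f ∈ₗ H → Nonempty (e ∩ f) → colour₂ e ≢ γ f
  colour₂-avoids-H {e} e∈G f∈H e∩f same =
    colour₂∉H-colours e∈G (subst (_∈ₗ H-colours e) (sym same) (H-colour∈ f∈H e∩f))

  separated : ∀ {e f} → e ∈ₗ E → f ∈ₗ E → e ≢ f → Nonempty (e ∩ f) → colour e (rank e) ≢ colour f (rank f)
  separated {e} {f} e∈E f∈E e≢f e∩f with rank e in rank-e | rank f in rank-f
  ... | 0 | _ = contradiction e∩f (rank0⇒disjoint rank-e)
  ... | _ | 0 = contradiction (∩-sym-Nonempty e∩f) (rank0⇒disjoint rank-f)
  ... | 1 | 1 = contradiction (rank1-meeting⇒≡ rank-e rank-f e∩f) e≢f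
  ... | 1 | 2 = colour₁-avoids-G rank-e (∈G f∈E rank-f) e∩f
  ... | 1 | suc (suc (suc _)) = colour₁-avoids-H rank-e (∈H f∈E rank-f) e∩f
  ... | 2 | 1 = ≢-sym (colour₁-avoids-G rank-f (∈G e∈E rank-e) (∩-sym-Nonempty e∩f))
  ... | 2 | 2 = λ same → meeting⇒¬Disjoint e∩f (colour₂-proper e f (∈G e∈E rank-e) (∈G f∈E rank-f) e≢f same)
  ... | 2 | suc (suc (suc _)) = colour₂-avoids-H (∈G e∈E rank-e) (∈H f∈E rank-f) e∩f
  ... | suc (suc (suc _)) | 1 = ≢-sym (colour₁-avoids-H rank-f (∈H e∈E rank-e) (∩-sym-Nonempty e∩f))
  ... | suc (suc (suc _)) | 2 = ≢-sym (colour₂-avoids-H (∈G f∈E rank-f) (∈H e∈E rank-e) (∩-sym-Nonempty e∩f))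
  ... | suc (suc (suc _)) | suc (suc (suc _)) =
    λ same → meeting⇒¬Disjoint e∩f (γ-proper e f (∈H e∈E rank-e) (∈H f∈E rank-f) e≢f same)

  δ-proper : IsEdgeColoring E δ
  δ-proper e f e∈E f∈E e≢f same x x∈e x∈f = separated e∈E f∈E e≢f (x , x∈p∩q⁺ (x∈e , x∈f)) same

  δ-extends-γ : ∀ e → e ∈ₗ H → δ e ≡ γ e
  δ-extends-γ e e∈H = large (proj₂ (∈-filter⁻ (λ e → 3 ≤? rank e) {xs = E} e∈H))
    where
    large : ∀ {r} → 3 ≤ r → colour e r ≡ γ e
    large (s≤s (s≤s (s≤s _))) = refl

corollary11 : ListEdgeColoringConjecture →
    ∀ n (E : Hypergraph n) → IsHypergraph E → Linear E →
    (∀ x → 2 * (maxDegree (H₃ E) ∸ degree (H₃ E) x) ≤ excess E x) →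
    (γ : Subset n → Fin n) → IsEdgeColoring (H₃ E) γ →
    Σ (Subset n → Fin n) λ δ → IsEdgeColoring E δ × (∀ e → e ∈ₗ H₃ E → δ e ≡ γ e)
corollary11 list-colouring n E E-unique E-linear excess-large γ γ-proper = δ , δ-proper , δ-extends-γ
  where open Extension list-colouring E E-unique E-linear excess-large γ γ-proper
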